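{- Let $\beta=(\beta_1,\beta_2,\ldots,\beta_s)$ be a composition with $s$ odd, let $F(\beta)$ be the corresponding fence, let $n=\#F(\beta)$, and let $r_0,r_1,\ldots,r_n$ be the rank sequence of the distributive lattice $L(\beta)$ of lower order ideals of $F(\beta)$, i.e. $r_k$ is the number of lower order ideals of $F(\beta)$ with exactly $k$ elements. Then for all $k$ with $0\le k\le\min\{\beta_1,\beta_s\}$ we have $r_k=r_{n-k}$.
   Context: A composition is a finite sequence $\beta=(\beta_1,\ldots,\beta_s)$ of positive integers. The fence $F(\beta)$ is the poset obtained by taking chains $S_1,\ldots,S_s$, where $S_i$ has length $\beta_i$ (i.e. $\beta_i+1$ elements), and identifying the maximal elements of $S_i$ and $S_{i+1}$ for $i$ odd and the minimal elements of $S_i$ and $S_{i+1}$ for $i$ even. Its cover relations are thus $x_1\lessdot x_2\lessdot\cdots\lessdot x_{\beta_1+1}\gtrdot x_{\beta_1+2}\gtrdot\cdots\gtrdot x_{\beta_1+\beta_2+1}\lessdot\cdots$, and $\#F(\beta)=1+\sum_i\beta_i$. Ideals are lower order ideals, ordered by inclusion in $L(\beta)$; the rank of an ideal is its cardinality. -}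

module Defs where

open import Data.Nat using (ℕ; zero; suc; _+_; _∸_; _⊓_)
open import Data.Bool using (Bool; true; false; _∧_; not; _∨_; if_then_else_)
open import Data.Nat.ListAction using (sum)
open import Data.List using (List; []; _∷_; replicate; _++_; length; filter; map; concatMap; last)
open import Data.Vec using (Vec; []; _∷_; toList)
open import Data.Fin using (Fin)
open import Data.Fin.Subset using (Subset; ∣_∣)
open import Data.Maybe using (Maybe; just; nothing)
open import Data.List.Relation.Unary.All using (All)
open import Relation.Binary.PropositionalEquality using (_≡_)
open import Data.Nat using (_≟_)
open import Relation.Nullary.Decidable using (⌊_⌋)

IsComposition : List ℕ → Set
IsComposition β = All (λ b → 1 Data.Nat.≤ b) β

fenceSize : List ℕ → ℕ
fenceSize β = suc (sum β)

-- Direction of the covering relation between consecutive elements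
-- x_j and x_{j+1} (0-indexed j = 0 .. Σβ - 1): true  means x_j ⋖ x_{j+1},
-- false means x_j ⋗ x_{j+1}.  Segment S_i (i = 1,2,..., i odd: ascending,
-- i even: descending) contributes βᵢ edges.
dirsFrom : Bool → List ℕ → List Bool
dirsFrom up []       = []
dirsFrom up (b ∷ β)  = replicate b up ++ dirsFrom (not up) β

directions : List ℕ → List Bool
directions β = dirsFrom true β

-- A subset (as a list of membership bits along x_0, x_1, ...) is a lower
-- order ideal iff it is downward closed under every cover relation
-- (the order of F(β) is the reflexive-transitive closure of the covers).
closedDown : List Bool → List Bool → Bool
closedDown (d ∷ ds) (a ∷ b ∷ xs) =
  (if d then (not b ∨ a)      -- x_j ⋖ x_{j+1}: x_{j+1} ∈ I ⇒ x_j ∈ I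
        else (not a ∨ b))     -- x_j ⋗ x_{j+1}: x_j ∈ I ⇒ x_{j+1} ∈ I
  ∧ closedDown ds (b ∷ xs)
closedDown _ _ = true

isLowerIdeal : (β : List ℕ) → Subset (fenceSize β) → Bool
isLowerIdeal β I = closedDown (directions β) (toList I)

allSubsets : (n : ℕ) → List (Subset n)
allSubsets zero    = [] ∷ []
allSubsets (suc n) = map (true ∷_) (allSubsets n) ++ map (false ∷_) (allSubsets n)

rank : (β : List ℕ) → ℕ → ℕ
rank β k = length (filter (λ I → (isLowerIdeal β I ∧ ⌊ ∣ I ∣ ≟ k ⌋) Data.Bool.≟ true)
                          (allSubsets (fenceSize β)))

-- First and last parts of a composition (0 for the empty list; unused since s is odd).
firstPart : List ℕ → ℕ
firstPart []      = 0
firstPart (b ∷ _) = b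

lastPart : List ℕ → ℕ
lastPart []          = 0
lastPart (b ∷ [])    = b
lastPart (_ ∷ c ∷ β) = lastPart (c ∷ β)

-- A pair (x , y) of series in ℤ[[q]] records the rank generating functions of the ideals
-- of a fence that omit / contain its first element.  Prepending an element below, resp.
-- above, the first one acts by U = [[1, 0], [q, q]], resp. D = [[1, 1], [0, q]], and the
-- matrix S = [[1 − q, 1], [q, q − 1]] satisfies S U = D S, S D = U S and
-- (1, q) S = (1 − q + q²) (1, 1).  So (1 − q + q²) R_F(q) is the (1, q)-weighted sum of the
-- pair of the dual fence F* computed from S v₀ instead of the one-point pair v₀.  Both ends
-- of F* are runs of descents, of lengths β₁ and β_s.  Along the last one the defect
-- S v₀ − (1 − q + q²) v₀, which is q times an eigenvector of D for the eigenvalue q, becomes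
-- divisible by q^(β_s + 1); along the first one the second component becomes divisible by
-- q^(β₁ + 1), so the weights (1, q) and (1, 1) agree there.  Hence
-- (1 − q + q²) R_F ≡ (1 − q + q²) R_F* mod q^(1 + min(β₁, β_s)); cancelling the unit
-- 1 − q + q² gives r_k(F) = r_k(F*), and complementation gives r_k(F*) = r_(n − k)(F).

module Submission where

open import Defs
open import Data.Bool using (Bool; true; false; not; _∧_; _∨_; if_then_else_)
import Data.Bool as Bool
open import Data.Bool.Properties using (not-involutive; ∧-zeroʳ; ∨-comm)
open import Data.Empty using (⊥-elim)
open import Data.Fin.Subset using (Subset; ∣_∣; ∁)
open import Data.Fin.Subset.Properties using (∣∁p∣≡n∸∣p∣; ∣p∣≤n)
open import Data.Integer using (ℤ; +_; 0ℤ; 1ℤ)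
import Data.Integer as ℤ
import Data.Integer.Properties as ℤ
open import Data.List using (List; []; _∷_; _++_; replicate; foldr; map; length; filter)
open import Data.List.Properties
  using (foldr-++; filter-++; length-++; length-map; length-replicate; map-++; map-replicate; ++-assoc; ++-identityʳ)
open import Data.Nat using (ℕ; zero; suc; _∸_; _⊓_; _≤_; _<_; s≤s; s<s; _≟_)
open import Data.Nat.ListAction using (sum)
open import Data.Nat.Properties
  using (≤-trans; n<1+n; n≤1+n; m<n⇒m<1+n; m<1+n⇒m<n∨m≡n; m⊓n≤m; m⊓n≤n; +-comm; +-suc; suc-injective;
         m∸[m∸n]≡n; m≤m+n; 0≢1+n)
open import Data.Product using (Σ; _×_; _,_; proj₁; proj₂)
open import Data.Sum using (inj₁; inj₂)
open import Data.Vec using ([]; _∷_; toList)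
open import Data.Vec.Properties using (toList-map)
open import Function using (_∘_)
open import Function.Bundles using (_⇔_; mk⇔)
open import Level using (0ℓ)
open import Relation.Binary.Bundles using (Setoid)
open import Relation.Binary.PropositionalEquality using (_≡_; _≗_; refl; sym; trans; cong; cong₂; module ≡-Reasoning)
import Relation.Binary.Reasoning.Setoid as SetoidReasoning
open import Relation.Nullary using (Dec)
open import Relation.Nullary.Decidable using (⌊_⌋; isYes≗does; does-⇔)

module _ where
  open import Data.Integer using (_+_; _-_)
  open import Data.Integer.Properties using (+-identityˡ; +-identityʳ)
  open import Data.Integer.Tactic.RingSolver using (solve-∀)

  Series : Set
  Series = ℕ → ℤ

  private
    variable
      p r : Series
      M N : ℕ

  infixl 6 _⊕_ _⊖_
  infixr 8 q·_

  _⊕_ _⊖_ : Series → Series → Series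
  (p ⊕ r) k = p k + r k
  (p ⊖ r) k = p k - r k

  q·_ : Series → Series
  (q· p) zero    = 0ℤ
  (q· p) (suc k) = p k

  0ₛ one : Series
  0ₛ _ = 0ℤ
  one zero    = 1ℤ
  one (suc _) = 0ℤ

  Φ₆ : Series → Series
  Φ₆ p = p ⊖ q· p ⊕ q· q· p

  q·-cong : p ≗ r → q· p ≗ q· r
  q·-cong p≗r zero    = refl
  q·-cong p≗r (suc k) = p≗r k

  Φ₆-q· : ∀ p → Φ₆ (q· p) ≗ q· Φ₆ p
  Φ₆-q· p zero    = refl
  Φ₆-q· p (suc k) = refl

  Φ₆-⊕ : ∀ p r → Φ₆ (p ⊕ r) ≗ Φ₆ p ⊕ Φ₆ r
  Φ₆-⊕ p r = λ where
      zero          → ring (p 0) (r 0) 0ℤ 0ℤ 0ℤ 0ℤ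
      (suc zero)    → ring (p 1) (r 1) (p 0) (r 0) 0ℤ 0ℤ
      (suc (suc k)) → ring (p (suc (suc k))) (r (suc (suc k))) (p (suc k)) (r (suc k)) (p k) (r k)
    where
    ring : ∀ a b c d e f → a + b - (c + d) + (e + f) ≡ a - c + e + (b - d + f)
    ring = solve-∀

  infix 4 _≡[<_]_
  _≡[<_]_ : Series → ℕ → Series → Set
  p ≡[< N ] r = ∀ k → k < N → p k ≡ r k

  ≗⇒≡[<] : p ≗ r → p ≡[< N ] r
  ≗⇒≡[<] p≗r k _ = p≗r k

  ≡[<]-mono : M ≤ N → p ≡[< N ] r → p ≡[< M ] r
  ≡[<]-mono M≤N p≡r k k<M = p≡r k (≤-trans k<M M≤N)

  ≡[<]-extend : p ≡[< N ] r → p N ≡ r N → p ≡[< suc N ] r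
  ≡[<]-extend p≡r pN≡rN k k<1+N with m<1+n⇒m<n∨m≡n k<1+N
  ... | inj₁ k<N  = p≡r k k<N
  ... | inj₂ refl = pN≡rN

  ⊕-≡[<] : ∀ {p p′ r r′} → p ≡[< N ] p′ → r ≡[< N ] r′ → p ⊕ r ≡[< N ] p′ ⊕ r′
  ⊕-≡[<] p≡p′ r≡r′ k k<N = cong₂ _+_ (p≡p′ k k<N) (r≡r′ k k<N)

  q·-≡[<] : p ≡[< N ] r → q· p ≡[< suc N ] q· r
  q·-≡[<] p≡r zero    _           = refl
  q·-≡[<] p≡r (suc k) (s<s k<N) = p≡r k k<N

  q·-vanish : p ≡[< N ] 0ₛ → q· p ≡[< suc N ] 0ₛ
  q·-vanish p≡0 zero    _           = refl
  q·-vanish p≡0 (suc k) (s<s k<N) = p≡0 k k<N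

  agreement : ℕ → Setoid 0ℓ 0ℓ
  agreement N = record
    { Carrier       = Series
    ; _≈_           = _≡[< N ]_
    ; isEquivalence = record
      { refl  = λ _ _ → refl
      ; sym   = λ p≡r k k<N → sym (p≡r k k<N)
      ; trans = λ p≡r r≡s k k<N → trans (p≡r k k<N) (r≡s k k<N)
      }
    }

  -- Φ₆ is invertible in ℤ[[q]] because its constant term is 1.
  Φ₆-cancel : ∀ N → Φ₆ p ≡[< N ] Φ₆ r → p ≡[< N ] r
  Φ₆-cancel zero    _         k ()
  Φ₆-cancel {p} {r} (suc N) Φ₆p≡Φ₆r = ≡[<]-extend p≡r (begin
      p N                             ≡⟨ unfold-Φ₆ p ⟩
      Φ₆ p N + (q· p) N - (q· q· p) N ≡⟨ cong₂ _-_ (cong₂ _+_ (Φ₆p≡Φ₆r N (n<1+n N)) (q·-≡[<] p≡r N (n<1+n N)))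
                                                    (q·-≡[<] (q·-≡[<] p≡r) N (m<n⇒m<1+n (n<1+n N))) ⟩
      Φ₆ r N + (q· r) N - (q· q· r) N ≡⟨ unfold-Φ₆ r ⟨
      r N                             ∎)
    where
    open ≡-Reasoning
    p≡r : p ≡[< N ] r
    p≡r = Φ₆-cancel N (≡[<]-mono (n≤1+n N) Φ₆p≡Φ₆r)
    ring : ∀ a b c → a ≡ a - b + c + b - c
    ring = solve-∀
    unfold-Φ₆ : ∀ s → s N ≡ Φ₆ s N + (q· s) N - (q· q· s) N
    unfold-Φ₆ s = ring (s N) ((q· s) N) ((q· q· s) N)

  Pair : Set
  Pair = Series × Series

  infix 4 _≗²_ _≡²[<_]_
  _≗²_ : Pair → Pair → Set
  u ≗² w = proj₁ u ≗ proj₁ w × proj₂ u ≗ proj₂ w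

  _≡²[<_]_ : Pair → ℕ → Pair → Set
  u ≡²[< N ] w = proj₁ u ≡[< N ] proj₁ w × proj₂ u ≡[< N ] proj₂ w

  ≗²⇒≡²[<] : ∀ {u w} → u ≗² w → u ≡²[< N ] w
  ≗²⇒≡²[<] (x≗x′ , y≗y′) = ≗⇒≡[<] x≗x′ , ≗⇒≡[<] y≗y′

  ≡²[<]-trans : ∀ {u v w} → u ≡²[< N ] v → v ≡²[< N ] w → u ≡²[< N ] w
  ≡²[<]-trans {N = N} (x≡x′ , y≡y′) (x′≡x″ , y′≡y″) =
    Setoid.trans (agreement N) x≡x′ x′≡x″ , Setoid.trans (agreement N) y≡y′ y′≡y″

  infixl 6 _⊕²_
  _⊕²_ : Pair → Pair → Pair
  (x , y) ⊕² (x′ , y′) = x ⊕ x′ , y ⊕ y′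

  Φ₆² : Pair → Pair
  Φ₆² (x , y) = Φ₆ x , Φ₆ y

  total : Pair → Series
  total (x , y) = x ⊕ y

  total-≡[<] : ∀ {u w} → u ≡²[< N ] w → total u ≡[< N ] total w
  total-≡[<] (x≡x′ , y≡y′) = ⊕-≡[<] x≡x′ y≡y′

  total-Φ₆² : ∀ u → total (Φ₆² u) ≗ Φ₆ (total u)
  total-Φ₆² (x , y) k = sym (Φ₆-⊕ x y k)

  -- extend d prepends a new first element, covered by the old one if d is true and
  -- covering it if d is false.
  extend : Bool → Pair → Pair
  extend true  (x , y) = x , q· (x ⊕ y)
  extend false (x , y) = x ⊕ y , q· y

  grow : List Bool → Pair → Pair
  grow ds v = foldr extend v ds

  grow-++ : ∀ xs ys v → grow (xs ++ ys) v ≡ grow xs (grow ys v)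
  grow-++ xs ys v = foldr-++ extend v xs ys

  singleton : Pair
  singleton = one , q· one

  rankGF : List Bool → Series
  rankGF ds = total (grow ds singleton)

  extend-≡²[<] : ∀ d {u w} → u ≡²[< N ] w → extend d u ≡²[< N ] extend d w
  extend-≡²[<] true  (x≡x′ , y≡y′) = x≡x′ , ≡[<]-mono (n≤1+n _) (q·-≡[<] (⊕-≡[<] x≡x′ y≡y′))
  extend-≡²[<] false (x≡x′ , y≡y′) = ⊕-≡[<] x≡x′ y≡y′ , ≡[<]-mono (n≤1+n _) (q·-≡[<] y≡y′)

  grow-≡²[<] : ∀ ds {u w} → u ≡²[< N ] w → grow ds u ≡²[< N ] grow ds w
  grow-≡²[<] []       u≡w = u≡w
  grow-≡²[<] (d ∷ ds) u≡w = extend-≡²[<] d (grow-≡²[<] ds u≡w)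

  Φ₆²-extend : ∀ d u → Φ₆² (extend d u) ≗² extend d (Φ₆² u)
  Φ₆²-extend true  (x , y) = (λ _ → refl) , λ k → trans (Φ₆-q· (x ⊕ y) k) (q·-cong (Φ₆-⊕ x y) k)
  Φ₆²-extend false (x , y) = Φ₆-⊕ x y , Φ₆-q· y

  Φ₆²-grow : ∀ ds u → Φ₆² (grow ds u) ≡²[< N ] grow ds (Φ₆² u)
  Φ₆²-grow []       u = (λ _ _ → refl) , (λ _ _ → refl)
  Φ₆²-grow (d ∷ ds) u =
    ≡²[<]-trans (≗²⇒≡²[<] (Φ₆²-extend d (grow ds u))) (extend-≡²[<] d (Φ₆²-grow ds u))

  twist : Pair → Pair
  twist (x , y) = x ⊖ q· x ⊕ y , q· x ⊕ q· y ⊖ y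

  shiftedTotal : Pair → Series
  shiftedTotal (x , y) = x ⊕ q· y

  shiftedTotal-≡[<] : ∀ {u w} → u ≡²[< N ] w → shiftedTotal u ≡[< N ] shiftedTotal w
  shiftedTotal-≡[<] (x≡x′ , y≡y′) = ⊕-≡[<] x≡x′ (≡[<]-mono (n≤1+n _) (q·-≡[<] y≡y′))

  twist-extend : ∀ d v → twist (extend d v) ≗² extend (not d) (twist v)
  twist-extend true (x , y) =
    (λ where
      zero    → ring₁ (x 0) 0ℤ 0ℤ (y 0)
      (suc k) → ring₁ (x (suc k)) (x k) (y k) (y (suc k))) ,
    (λ where
      zero          → refl
      (suc zero)    → ring₂ (x 0) (y 0) 0ℤ 0ℤ
      (suc (suc k)) → ring₂ (x (suc k)) (y (suc k)) (x k) (y k))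
    where
    ring₁ : ∀ a b c d → a - b + (b + c) ≡ a - b + d + (b + c - d)
    ring₁ = solve-∀
    ring₂ : ∀ b c e f → b + (e + f) - (b + c) ≡ e + f - c
    ring₂ = solve-∀
  twist-extend false (x , y) =
    (λ where
      zero    → ring₁ (x 0) 0ℤ 0ℤ (y 0)
      (suc k) → ring₁ (x (suc k)) (x k) (y k) (y (suc k))) ,
    (λ where
      zero    → refl
      (suc k) → ring₂ (x k) ((q· x) k) ((q· y) k) (y k))
    where
    ring₁ : ∀ a b c d → a + d - (b + c) + c ≡ a - b + d
    ring₁ = solve-∀
    ring₂ : ∀ a b c d → a + d + c - d ≡ a - b + d + (b + c - d)
    ring₂ = solve-∀

  twist-grow : ∀ ds v → twist (grow ds v) ≡²[< N ] grow (map not ds) (twist v)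
  twist-grow []       v = (λ _ _ → refl) , (λ _ _ → refl)
  twist-grow (d ∷ ds) v =
    ≡²[<]-trans (≗²⇒≡²[<] (twist-extend d (grow ds v))) (extend-≡²[<] (not d) (twist-grow ds v))

  Φ₆-total : ∀ v → Φ₆ (total v) ≗ shiftedTotal (twist v)
  Φ₆-total (x , y) = λ where
      zero          → ring (x 0) 0ℤ 0ℤ (y 0) 0ℤ 0ℤ
      (suc zero)    → ring (x 1) (x 0) (y 0) (y 1) 0ℤ 0ℤ
      (suc (suc k)) → ring (x (suc (suc k))) (x (suc k)) (y (suc k)) (y (suc (suc k))) (x k) (y k)
    where
    ring : ∀ a b c d e g → a + d - (b + c) + (e + g) ≡ a - b + d + (e + g - c)
    ring = solve-∀

  -- (1 , q − 1) is an eigenvector of the down step with eigenvalue q.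
  eig : Series → Pair
  eig d = d , q· d ⊖ d

  eig-extend : ∀ {u w d} → u ≗² Φ₆² w ⊕² eig d → extend false u ≗² Φ₆² (extend false w) ⊕² eig (q· d)
  eig-extend {u₁ , u₂} {w₁ , w₂} {d} (u₁≗ , u₂≗) =
    (λ k → trans (cong₂ _+_ (u₁≗ k) (u₂≗ k))
             (trans (ring (Φ₆ w₁ k) (Φ₆ w₂ k) (d k) ((q· d) k)) (cong (_+ (q· d) k) (sym (Φ₆-⊕ w₁ w₂ k))))) ,
    (λ where
      zero    → refl
      (suc k) → u₂≗ k)
    where
    ring : ∀ a b c e → a + c + (b + (e - c)) ≡ a + b + e
    ring = solve-∀

  eig-negligible : ∀ {u w d} → d ≡[< N ] 0ₛ → u ≗² w ⊕² eig d → u ≡²[< N ] w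
  eig-negligible {N} {u₁ , u₂} {w₁ , w₂} {d} d≡0 (u₁≗ , u₂≗) =
    (λ k k<N → trans (u₁≗ k) (trans (cong (_+_ (w₁ k)) (d≡0 k k<N)) (+-identityʳ (w₁ k)))) ,
    (λ k k<N → trans (u₂≗ k) (trans (cong (_+_ (w₂ k)) (cong₂ _-_ (q·-vanish d≡0 k (m<n⇒m<1+n k<N)) (d≡0 k k<N)))
                                     (+-identityʳ (w₂ k))))

  twist-singleton : twist singleton ≗² Φ₆² singleton ⊕² eig (q· (one ⊖ q· one))
  twist-singleton = (λ where
      0 → refl
      1 → refl
      2 → refl
      (suc (suc (suc k))) → refl) ,
    (λ where
      0 → refl
      1 → refl
      2 → refl
      3 → refl
      (suc (suc (suc (suc k)))) → refl)

  descents-eig : ∀ e → Σ Series λ d → d ≡[< suc e ] 0ₛ ×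
    grow (replicate e false) (twist singleton) ≗² Φ₆² (grow (replicate e false) singleton) ⊕² eig d
  descents-eig zero = q· (one ⊖ q· one) , q·-vanish (λ _ ()) , twist-singleton
  descents-eig (suc e) with descents-eig e
  ... | d , d≡0 , twisted≗ = q· d , q·-vanish d≡0 , eig-extend {w = grow (replicate e false) singleton} twisted≗

  descents-twist : ∀ e →
    grow (replicate e false) (twist singleton) ≡²[< suc e ] Φ₆² (grow (replicate e false) singleton)
  descents-twist e with descents-eig e
  ... | d , d≡0 , twisted≗ = eig-negligible d≡0 twisted≗

  trailing-descents : ∀ {Y Y₂ e} → Y ≡ Y₂ ++ replicate e false →
    total (grow Y (twist singleton)) ≡[< suc e ] Φ₆ (rankGF Y)
  trailing-descents {Y₂ = Y₂} {e} refl = begin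
    total (grow (Y₂ ++ R) (twist singleton))     ≡⟨ cong total (grow-++ Y₂ R (twist singleton)) ⟩
    total (grow Y₂ (grow R (twist singleton)))   ≈⟨ total-≡[<] (grow-≡²[<] Y₂ (descents-twist e)) ⟩
    total (grow Y₂ (Φ₆² (grow R singleton)))      ≈⟨ total-≡[<] (Φ₆²-grow Y₂ (grow R singleton)) ⟨
    total (Φ₆² (grow Y₂ (grow R singleton)))      ≈⟨ ≗⇒≡[<] (total-Φ₆² (grow Y₂ (grow R singleton))) ⟩
    Φ₆ (total (grow Y₂ (grow R singleton)))       ≡⟨ cong (Φ₆ ∘ total) (grow-++ Y₂ R singleton) ⟨
    Φ₆ (rankGF (Y₂ ++ R))                         ∎
    where
    open SetoidReasoning (agreement (suc e))
    R : List Bool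
    R = replicate e false

  shiftedTotal-total : ∀ u → proj₂ u ≡[< N ] 0ₛ → shiftedTotal u ≡[< N ] total u
  shiftedTotal-total (x , y) y≡0 k k<N =
    cong (_+_ (x k)) (trans (q·-vanish y≡0 k (m<n⇒m<1+n k<N)) (sym (y≡0 k k<N)))

  proj₂-grow-twist : ∀ ds → proj₂ (grow ds (twist singleton)) ≡[< 1 ] 0ₛ
  proj₂-grow-twist []            zero _ = refl
  proj₂-grow-twist (true  ∷ ds) zero _ = refl
  proj₂-grow-twist (false ∷ ds) zero _ = refl
  proj₂-grow-twist _            (suc _) (s<s ())

  leading-descents : ∀ {Y Y₁ a} → Y ≡ replicate a false ++ Y₁ →
    shiftedTotal (grow Y (twist singleton)) ≡[< suc a ] total (grow Y (twist singleton))
  leading-descents {Y₁ = Y₁} {a} refl = shiftedTotal-total (grow (replicate a false ++ Y₁) (twist singleton)) (vanish a)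
    where
    vanish : ∀ a → proj₂ (grow (replicate a false ++ Y₁) (twist singleton)) ≡[< suc a ] 0ₛ
    vanish zero    = proj₂-grow-twist Y₁
    vanish (suc a) = q·-vanish (vanish a)

  rankGF-map-not : ∀ ds {a e Y₁ Y₂} →
    map not ds ≡ replicate a false ++ Y₁ → map not ds ≡ Y₂ ++ replicate e false →
    rankGF ds ≡[< suc (a ⊓ e) ] rankGF (map not ds)
  rankGF-map-not ds {a} {e} leading trailing = Φ₆-cancel (suc (a ⊓ e)) (begin
    Φ₆ (rankGF ds)                                      ≈⟨ ≗⇒≡[<] (Φ₆-total (grow ds singleton)) ⟩
    shiftedTotal (twist (grow ds singleton))            ≈⟨ shiftedTotal-≡[<] (twist-grow ds singleton) ⟩
    shiftedTotal (grow (map not ds) (twist singleton))  ≈⟨ ≡[<]-mono (s≤s (m⊓n≤m a e)) (leading-descents leading) ⟩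
    total (grow (map not ds) (twist singleton))         ≈⟨ ≡[<]-mono (s≤s (m⊓n≤n a e)) (trailing-descents trailing) ⟩
    Φ₆ (rankGF (map not ds))                            ∎)
    where open SetoidReasoning (agreement (suc (a ⊓ e)))

  sizeGF : (n : ℕ) → (Subset n → Bool) → Series
  sizeGF zero    p = if p [] then one else 0ₛ
  sizeGF (suc n) p = sizeGF n (λ I → p (false ∷ I)) ⊕ q· sizeGF n (λ I → p (true ∷ I))

  sizeGF² : (n : ℕ) → (Subset (suc n) → Bool) → Pair
  sizeGF² n p = sizeGF n (λ I → p (false ∷ I)) , q· sizeGF n (λ I → p (true ∷ I))

  q·-null : p ≗ 0ₛ → q· p ≗ 0ₛ
  q·-null p≗0 zero    = refl
  q·-null p≗0 (suc k) = p≗0 k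

  sizeGF-false : ∀ n → sizeGF n (λ _ → false) ≗ 0ₛ
  sizeGF-false zero    k = refl
  sizeGF-false (suc n) k = cong₂ _+_ (sizeGF-false n k) (q·-null (sizeGF-false n) k)

  sizeGF²-closedDown : ∀ ds → sizeGF² (length ds) (closedDown ds ∘ toList) ≗² grow ds singleton
  sizeGF²-closedDown []       = (λ _ → refl) , (λ _ → refl)
  sizeGF²-closedDown (d ∷ ds) = step d
    where
    n : ℕ
    n = length ds
    x y : Series
    x = proj₁ (sizeGF² n (closedDown ds ∘ toList))
    y = proj₂ (sizeGF² n (closedDown ds ∘ toList))
    x≗ : x ≗ proj₁ (grow ds singleton)
    x≗ = proj₁ (sizeGF²-closedDown ds)
    y≗ : y ≗ proj₂ (grow ds singleton)
    y≗ = proj₂ (sizeGF²-closedDown ds)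
    step : ∀ d → sizeGF² (suc n) (closedDown (d ∷ ds) ∘ toList) ≗² extend d (grow ds singleton)
    step true =
      (λ k → trans (cong (_+_ (x k)) (q·-null (sizeGF-false n) k)) (trans (+-identityʳ (x k)) (x≗ k))) ,
      q·-cong (λ k → cong₂ _+_ (x≗ k) (y≗ k))
    step false =
      (λ k → cong₂ _+_ (x≗ k) (y≗ k)) ,
      q·-cong (λ k → trans (cong (_+ y k) (sizeGF-false n k)) (trans (+-identityˡ (y k)) (y≗ k)))

open import Data.Nat using (_+_; _*_)
open import Data.Nat.Tactic.RingSolver using (solve-∀)

count : (n : ℕ) → (Subset n → Bool) → ℕ
count zero    p = if p [] then 1 else 0
count (suc n) p = count n (λ I → p (true ∷ I)) + count n (λ I → p (false ∷ I))

count-cong : ∀ n {p p′ : Subset n → Bool} → (∀ I → p I ≡ p′ I) → count n p ≡ count n p′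
count-cong zero    p≗p′ = cong (if_then 1 else 0) (p≗p′ [])
count-cong (suc n) p≗p′ = cong₂ _+_ (count-cong n (λ I → p≗p′ (true ∷ I))) (count-cong n (λ I → p≗p′ (false ∷ I)))

count-false : ∀ n → count n (λ _ → false) ≡ 0
count-false zero    = refl
count-false (suc n) = cong₂ _+_ (count-false n) (count-false n)

count-∁ : ∀ n (p : Subset n → Bool) → count n p ≡ count n (p ∘ ∁)
count-∁ zero    p = refl
count-∁ (suc n) p = trans (+-comm (count n (λ I → p (true ∷ I))) _)
  (cong₂ _+_ (count-∁ n (λ I → p (false ∷ I))) (count-∁ n (λ I → p (true ∷ I))))

length-filter-map : ∀ {A B : Set} (p : B → Bool) (f : A → B) xs →
  length (filter (λ y → p y Bool.≟ true) (map f xs)) ≡ length (filter (λ x → p (f x) Bool.≟ true) xs)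
length-filter-map p f []       = refl
length-filter-map p f (x ∷ xs) with p (f x)
... | true  = cong suc (length-filter-map p f xs)
... | false = length-filter-map p f xs

length-filter-allSubsets : ∀ n (p : Subset n → Bool) →
  length (filter (λ I → p I Bool.≟ true) (allSubsets n)) ≡ count n p
length-filter-allSubsets zero p with p []
... | true  = refl
... | false = refl
length-filter-allSubsets (suc n) p = begin
  length (filter P? (map (true ∷_) A ++ map (false ∷_) A))
    ≡⟨ cong length (filter-++ P? (map (true ∷_) A) (map (false ∷_) A)) ⟩
  length (filter P? (map (true ∷_) A) ++ filter P? (map (false ∷_) A))
    ≡⟨ length-++ (filter P? (map (true ∷_) A)) ⟩
  length (filter P? (map (true ∷_) A)) + length (filter P? (map (false ∷_) A))
    ≡⟨ cong₂ _+_ (branch true) (branch false) ⟩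
  count (suc n) p ∎
  where
  open ≡-Reasoning
  A : List (Subset n)
  A = allSubsets n
  P? : (I : Subset (suc n)) → Dec (p I ≡ true)
  P? I = p I Bool.≟ true
  branch : ∀ b → length (filter P? (map (b ∷_) A)) ≡ count n (λ I → p (b ∷ I))
  branch b = trans (length-filter-map p (b ∷_) A) (length-filter-allSubsets n (λ I → p (b ∷ I)))

⌊⌋-⇔ : ∀ {A B : Set} → A ⇔ B → (a? : Dec A) (b? : Dec B) → ⌊ a? ⌋ ≡ ⌊ b? ⌋
⌊⌋-⇔ A⇔B a? b? = trans (isYes≗does a?) (trans (does-⇔ A⇔B a? b?) (sym (isYes≗does b?)))

⌊suc≟suc⌋ : ∀ m n → ⌊ suc m ≟ suc n ⌋ ≡ ⌊ m ≟ n ⌋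
⌊suc≟suc⌋ m n = ⌊⌋-⇔ (mk⇔ suc-injective (cong suc)) (suc m ≟ suc n) (m ≟ n)

count-sizeGF : ∀ n (p : Subset n → Bool) k → + count n (λ I → p I ∧ ⌊ ∣ I ∣ ≟ k ⌋) ≡ sizeGF n p k
count-sizeGF zero p zero with p []
... | true  = refl
... | false = refl
count-sizeGF zero p (suc k) with p []
... | true  = refl
... | false = refl
count-sizeGF (suc n) p k =
  trans (cong +_ (+-comm (count n (λ I → p (true ∷ I) ∧ ⌊ suc ∣ I ∣ ≟ k ⌋))
                         (count n (λ I → p (false ∷ I) ∧ ⌊ ∣ I ∣ ≟ k ⌋))))
        (cong₂ ℤ._+_ (count-sizeGF n (λ I → p (false ∷ I)) k) (shifted k))
  where
  shifted : ∀ k → + count n (λ I → p (true ∷ I) ∧ ⌊ suc ∣ I ∣ ≟ k ⌋) ≡ (q· sizeGF n (λ I → p (true ∷ I))) k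
  shifted zero    = cong +_ (trans (count-cong n (λ I → ∧-zeroʳ (p (true ∷ I)))) (count-false n))
  shifted (suc k) = trans (cong +_ (count-cong n (λ I → cong (p (true ∷ I) ∧_) (⌊suc≟suc⌋ ∣ I ∣ k))))
                          (count-sizeGF n (λ I → p (true ∷ I)) k)

count-dual : ∀ n (p : Subset n → Bool) k → k ≤ n →
  count n (λ I → p I ∧ ⌊ ∣ I ∣ ≟ n ∸ k ⌋) ≡ count n (λ I → p (∁ I) ∧ ⌊ ∣ I ∣ ≟ k ⌋)
count-dual n p k k≤n = trans (count-∁ n _) (count-cong n (λ I → cong (p (∁ I) ∧_) (size-∁ I)))
  where
  size-∁ : ∀ I → ⌊ ∣ ∁ I ∣ ≟ n ∸ k ⌋ ≡ ⌊ ∣ I ∣ ≟ k ⌋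
  size-∁ I = ⌊⌋-⇔ (mk⇔ to from) (∣ ∁ I ∣ ≟ n ∸ k) (∣ I ∣ ≟ k)
    where
    to : ∣ ∁ I ∣ ≡ n ∸ k → ∣ I ∣ ≡ k
    to eq = begin
      ∣ I ∣           ≡⟨ m∸[m∸n]≡n (∣p∣≤n I) ⟨
      n ∸ (n ∸ ∣ I ∣) ≡⟨ cong (n ∸_) (∣∁p∣≡n∸∣p∣ I) ⟨
      n ∸ ∣ ∁ I ∣     ≡⟨ cong (n ∸_) eq ⟩
      n ∸ (n ∸ k)     ≡⟨ m∸[m∸n]≡n k≤n ⟩
      k               ∎
      where open ≡-Reasoning
    from : ∣ I ∣ ≡ k → ∣ ∁ I ∣ ≡ n ∸ k
    from eq = trans (∣∁p∣≡n∸∣p∣ I) (cong (n ∸_) eq)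

closedDown-map-not : ∀ ds xs → closedDown ds (map not xs) ≡ closedDown (map not ds) xs
closedDown-map-not []           xs           = refl
closedDown-map-not (d ∷ ds)     []           = refl
closedDown-map-not (d ∷ ds)     (a ∷ [])     = refl
closedDown-map-not (true ∷ ds)  (a ∷ b ∷ xs) =
  cong₂ _∧_ (trans (cong (_∨ not a) (not-involutive b)) (∨-comm b (not a))) (closedDown-map-not ds (b ∷ xs))
closedDown-map-not (false ∷ ds) (a ∷ b ∷ xs) =
  cong₂ _∧_ (trans (cong (_∨ not b) (not-involutive a)) (∨-comm a (not b))) (closedDown-map-not ds (b ∷ xs))

count-closedDown : ∀ ds {n} → length ds ≡ n → ∀ k →
  + count (suc n) (λ I → closedDown ds (toList I) ∧ ⌊ ∣ I ∣ ≟ k ⌋) ≡ rankGF ds k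
count-closedDown ds refl k = trans (count-sizeGF (suc (length ds)) (closedDown ds ∘ toList) k)
  (cong₂ ℤ._+_ (proj₁ (sizeGF²-closedDown ds) k) (proj₂ (sizeGF²-closedDown ds) k))

length-dirsFrom : ∀ b β → length (dirsFrom b β) ≡ sum β
length-dirsFrom b []      = refl
length-dirsFrom b (x ∷ β) =
  trans (length-++ (replicate x b)) (cong₂ _+_ (length-replicate x) (length-dirsFrom (not b) β))

map-not-dirsFrom : ∀ b β → map not (dirsFrom b β) ≡ dirsFrom (not b) β
map-not-dirsFrom b []      = refl
map-not-dirsFrom b (x ∷ β) = trans (map-++ not (replicate x b) (dirsFrom (not b) β))
  (cong₂ _++_ (map-replicate not x b) (map-not-dirsFrom (not b) β))

rank-rankGF : ∀ β k → + rank β k ≡ rankGF (directions β) k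
rank-rankGF β k = trans (cong +_ (length-filter-allSubsets (fenceSize β) _))
  (count-closedDown (directions β) (length-dirsFrom true β) k)

rank-dual-rankGF : ∀ β k → k ≤ fenceSize β → + rank β (fenceSize β ∸ k) ≡ rankGF (map not (directions β)) k
rank-dual-rankGF β k k≤n = trans (cong +_ (begin
  rank β (fenceSize β ∸ k)
    ≡⟨ length-filter-allSubsets (fenceSize β) _ ⟩
  count (fenceSize β) (λ I → closedDown ds (toList I) ∧ ⌊ ∣ I ∣ ≟ fenceSize β ∸ k ⌋)
    ≡⟨ count-dual (fenceSize β) (closedDown ds ∘ toList) k k≤n ⟩
  count (fenceSize β) (λ I → closedDown ds (toList (∁ I)) ∧ ⌊ ∣ I ∣ ≟ k ⌋)
    ≡⟨ count-cong (fenceSize β) (λ I → cong (_∧ ⌊ ∣ I ∣ ≟ k ⌋) (closedDown-∁ I)) ⟩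
  count (fenceSize β) (λ I → closedDown (map not ds) (toList I) ∧ ⌊ ∣ I ∣ ≟ k ⌋) ∎))
  (count-closedDown (map not ds) (trans (length-map not ds) (length-dirsFrom true β)) k)
  where
  open ≡-Reasoning
  ds : List Bool
  ds = directions β
  closedDown-∁ : ∀ I → closedDown ds (toList (∁ I)) ≡ closedDown (map not ds) (toList I)
  closedDown-∁ I = trans (cong (closedDown ds) (toList-map not I)) (closedDown-map-not ds (toList I))

2m+1≡1+m+m : ∀ m → 2 * m + 1 ≡ suc (m + m)
2m+1≡1+m+m = solve-∀

dirsFrom-odd : ∀ m β → length β ≡ suc (m + m) → ∀ b →
  Σ (List Bool) λ X → dirsFrom b β ≡ X ++ replicate (lastPart β) b
dirsFrom-odd zero    (x ∷ [])         _   b = [] , ++-identityʳ (replicate x b)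
dirsFrom-odd (suc m) (x ∷ y ∷ [])     len b with trans (suc-injective (suc-injective len)) (+-suc m m)
... | ()
dirsFrom-odd (suc m) (x ∷ y ∷ z ∷ β) len b
  with X , eq ← dirsFrom-odd m (z ∷ β) (trans (suc-injective (suc-injective len)) (+-suc m m)) b =
  replicate x b ++ replicate y (not b) ++ X , (begin
    replicate x b ++ replicate y (not b) ++ dirsFrom (not (not b)) (z ∷ β)
      ≡⟨ cong (λ c → replicate x b ++ replicate y (not b) ++ dirsFrom c (z ∷ β)) (not-involutive b) ⟩
    replicate x b ++ replicate y (not b) ++ dirsFrom b (z ∷ β)
      ≡⟨ cong (λ Z → replicate x b ++ replicate y (not b) ++ Z) eq ⟩
    replicate x b ++ replicate y (not b) ++ X ++ R
      ≡⟨ cong (replicate x b ++_) (++-assoc (replicate y (not b)) X R) ⟨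
    replicate x b ++ (replicate y (not b) ++ X) ++ R
      ≡⟨ ++-assoc (replicate x b) (replicate y (not b) ++ X) R ⟨
    (replicate x b ++ replicate y (not b) ++ X) ++ R ∎)
  where
  open ≡-Reasoning
  R : List Bool
  R = replicate (lastPart (z ∷ β)) b

-- The parts need not be positive.
theorem1p3 : (β : List ℕ) → IsComposition β → (m : ℕ) → length β ≡ 2 * m + 1 →
    (k : ℕ) → k ≤ firstPart β ⊓ lastPart β →
    rank β k ≡ rank β (fenceSize β ∸ k)
theorem1p3 []               _ m len = ⊥-elim (0≢1+n (trans len (2m+1≡1+m+m m)))
theorem1p3 β@(b₁ ∷ β′) _ m len k k≤ with dirsFrom-odd m β (trans len (2m+1≡1+m+m m)) false
... | _ , trailing = ℤ.+-injective (begin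
  + rank β k                  ≡⟨ rank-rankGF β k ⟩
  rankGF ds k                 ≡⟨ rankGF-map-not ds leading (trans (map-not-dirsFrom true β) trailing) k (s≤s k≤) ⟩
  rankGF (map not ds) k       ≡⟨ rank-dual-rankGF β k k≤n ⟨
  + rank β (fenceSize β ∸ k)  ∎)
  where
  open ≡-Reasoning
  ds : List Bool
  ds = directions β
  leading : map not ds ≡ replicate b₁ false ++ dirsFrom true β′
  leading = map-not-dirsFrom true β
  k≤n : k ≤ fenceSize β
  k≤n = ≤-trans (≤-trans k≤ (m⊓n≤m b₁ (lastPart β))) (≤-trans (m≤m+n b₁ (sum β′)) (n≤1+n _))
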